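{- (a) If $h(x,\vec y/\vec a,b)$ is in ${\sf PCSF}$, then so is the function $f$ defined by predicative function recursion \[f(x,\vec y/\vec a)=h(x,\vec y/\vec a,f\upharpoonright x),\qquad\text{where } f\upharpoonright x=\{\langle z,f(z,\vec y/\vec a)\rangle: z\in x\}.\] (b) Conversely, every ${\sf PCSF}$-function is generated from ${\sf PCSF}^-$-functions and the projections $\pi^{n,m}_j$ by safe composition and predicative function recursion.
   Context: Ordered pairs are Kuratowski pairs $\langle c,d\rangle=\{\{c\},\{c,d\}\}$. Functions are set-theoretic functions on the universe of sets, written $f(x_1,\ldots,x_n/a_1,\ldots,a_m)$: arguments before the slash are called normal, after it safe (either list may be empty, written $-$). The class ${\sf PCSF}^-$ consists of functions with no normal arguments; it contains the projections $\pi^{ -,m}_j(-/a_1,\ldots,a_m)=a_j$, $\mathrm{pair}(-/a,b)=\{a,b\}$, $\mathrm{null}(-/-)=\emptyset$, $\mathrm{union}(-/a)=\bigcup a$, and $\mathrm{Cond}_\in(-/a,b,c,d)$, which equals $a$ if $c\in d$ and $b$ otherwise; and it is closed under composition $f(-/\vec a)=h(-/t_1(-/\vec a),\ldots,t_k(-/\vec a))$ and under safe separation: if $h(-/\vec a,b)\in{\sf PCSF}^-$ then $f(-/\vec a,c)=\{b\in c: h(-/\vec a,b)\neq\emptyset\}\in{\sf PCSF}^-$. The class ${\sf PCSF}$ is the smallest class containing ${\sf PCSF}^-$ and all projections $\pi^{n,m}_j(x_1,\ldots,x_n/x_{n+1},\ldots,x_{n+m})=x_j$ ($1\le j\le n+m$),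 and closed under safe composition $f(\vec x/\vec a)=h(r_1(\vec x/-),\ldots,r_k(\vec x/-)/t_1(\vec x/\vec a),\ldots,t_l(\vec x/\vec a))$ (with $h,r_i,t_j\in{\sf PCSF}$, the $r_i$ having no safe arguments) and predicative set recursion $f(x,\vec y/\vec a)=h(x,\vec y/\vec a,\{f(z,\vec y/\vec a): z\in x\})$ (with $h\in{\sf PCSF}$). -}

module Defs where

open import Data.Nat using (ℕ; zero; suc; _+_)
open import Data.Fin using (Fin)
open import Data.Vec using (Vec; []; _∷_; _∷ʳ_; init; last; lookup; tabulate; _++_)
open import Data.Product using (_×_; ∃; Σ; _,_)
open import Data.Sum using (_⊎_)
open import Relation.Nullary using (¬_; Dec; yes; no)
open import Relation.Binary.PropositionalEquality using (_≡_)
open import Induction.WellFounded using (WellFounded)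

-- A universe of sets: a model of the set-theoretic operations used in the paper.
-- Set equality is Agda's _≡_ (justified by the extensionality field).
record SetUniverse : Set₁ where
  field
    V      : Set
    _∈_    : V → V → Set
    _∈?_   : (a b : V) → Dec (a ∈ b)
    extensionality : ∀ a b → (∀ z → (z ∈ a → z ∈ b) × (z ∈ b → z ∈ a)) → a ≡ b
    ∈-wf   : WellFounded _∈_
    ∅      : V
    ∅-spec : ∀ z → ¬ (z ∈ ∅)
    pair   : V → V → V
    pair-spec : ∀ a b z → (z ∈ pair a b → (z ≡ a ⊎ z ≡ b)) × ((z ≡ a ⊎ z ≡ b) → z ∈ pair a b)
    ⋃      : V → V
    ⋃-spec : ∀ a z → (z ∈ ⋃ a → ∃ λ w → w ∈ a × z ∈ w) × ((∃ λ w → w ∈ a × z ∈ w) → z ∈ ⋃ a)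
    sep    : (V → Set) → V → V
    sep-spec : ∀ P c z → (z ∈ sep P c → z ∈ c × P z) × (z ∈ c × P z → z ∈ sep P c)
    image  : (V → V) → V → V
    image-spec : ∀ F x z → (z ∈ image F x → ∃ λ w → w ∈ x × z ≡ F w)
                         × ((∃ λ w → w ∈ x × z ≡ F w) → z ∈ image F x)

module _ (U : SetUniverse) where
  open SetUniverse U

  kpair : V → V → V
  kpair c d = pair (pair c c) (pair c d)

  -- a function with n normal and m safe arguments: f(x₁..xₙ / a₁..aₘ)
  Fn : ℕ → ℕ → Set
  Fn n m = Vec V n → Vec V m → V

  pairFn : Vec V 2 → V
  pairFn (a ∷ b ∷ []) = pair a b

  unionFn : Vec V 1 → V
  unionFn (a ∷ []) = ⋃ a

  condFn : Vec V 4 → V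
  condFn (a ∷ b ∷ c ∷ d ∷ []) with c ∈? d
  ... | yes _ = a
  ... | no _  = b

  -- PCSF⁻ : functions without normal arguments (represented as Vec V m → V)
  data PCSF⁻ : ∀ {m} → (Vec V m → V) → Set where
    proj⁻  : ∀ {m} (j : Fin m) → PCSF⁻ (λ as → lookup as j)
    pair⁻  : PCSF⁻ pairFn
    null⁻  : PCSF⁻ {0} (λ _ → ∅)
    union⁻ : PCSF⁻ unionFn
    cond⁻  : PCSF⁻ condFn
    comp⁻  : ∀ {m k} {h : Vec V k → V} {ts : Fin k → Vec V m → V} →
             PCSF⁻ h → (∀ i → PCSF⁻ (ts i)) →
             PCSF⁻ (λ as → h (tabulate (λ i → ts i as)))
    sep⁻   : ∀ {m} {h : Vec V (suc m) → V} → PCSF⁻ h →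
             PCSF⁻ (λ as → sep (λ b → ¬ (h (init as ∷ʳ b) ≡ ∅)) (last as))
    -- functions are extensional objects
    ext⁻   : ∀ {m} {g f : Vec V m → V} → PCSF⁻ g → (∀ as → f as ≡ g as) → PCSF⁻ f

  data PCSF : ∀ {n m} → Fn n m → Set where
    base  : ∀ {m} {g : Vec V m → V} → PCSF⁻ g → PCSF {0} {m} (λ _ as → g as)
    proj  : ∀ {n m} (j : Fin (n + m)) → PCSF {n} {m} (λ xs as → lookup (xs ++ as) j)
    scomp : ∀ {n m k l} {h : Fn k l} {rs : Fin k → Fn n 0} {ts : Fin l → Fn n m} →
            PCSF h → (∀ i → PCSF (rs i)) → (∀ j → PCSF (ts j)) →
            PCSF (λ xs as → h (tabulate (λ i → rs i xs [])) (tabulate (λ j → ts j xs as)))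
    srec  : ∀ {n m} {h : Fn (suc n) (suc m)} {f : Fn (suc n) m} → PCSF h →
            (∀ x ys as → f (x ∷ ys) as ≡ h (x ∷ ys) (as ∷ʳ image (λ z → f (z ∷ ys) as) x)) →
            PCSF f
    ext   : ∀ {n m} {g f : Fn n m} → PCSF g → (∀ xs as → f xs as ≡ g xs as) → PCSF f

  restrict : ∀ {n m} → Fn (suc n) m → Vec V n → Vec V m → V → V
  restrict f ys as x = image (λ z → kpair z (f (z ∷ ys) as)) x

  data PCSFfr : ∀ {n m} → Fn n m → Set where
    base  : ∀ {m} {g : Vec V m → V} → PCSF⁻ g → PCSFfr {0} {m} (λ _ as → g as)
    proj  : ∀ {n m} (j : Fin (n + m)) → PCSFfr {n} {m} (λ xs as → lookup (xs ++ as) j)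
    scomp : ∀ {n m k l} {h : Fn k l} {rs : Fin k → Fn n 0} {ts : Fin l → Fn n m} →
            PCSFfr h → (∀ i → PCSFfr (rs i)) → (∀ j → PCSFfr (ts j)) →
            PCSFfr (λ xs as → h (tabulate (λ i → rs i xs [])) (tabulate (λ j → ts j xs as)))
    frec  : ∀ {n m} {h : Fn (suc n) (suc m)} {f : Fn (suc n) m} → PCSFfr h →
            (∀ x ys as → f (x ∷ ys) as ≡ h (x ∷ ys) (as ∷ʳ restrict f ys as x)) →
            PCSFfr f
    ext   : ∀ {n m} {g f : Fn n m} → PCSFfr g → (∀ xs as → f xs as ≡ g xs as) → PCSFfr f

-- (a) If f(x,y⃗/a⃗) = h(x,y⃗/a⃗, f↾x), then G(x,y⃗/a⃗) = ⟨x, f(x,y⃗/a⃗)⟩ satisfies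
--     G(x,y⃗/a⃗) = ⟨x, h(x,y⃗/a⃗, {G(z,y⃗/a⃗) : z ∈ x})⟩, because {G(z) : z ∈ x}
--     is literally f↾x.  So G arises by set recursion, and
--     f(x,y⃗/a⃗) = second(x, G(x,y⃗/a⃗)) for a PCSF⁻ function `second`.
-- (b) Induction on PCSF-derivations.  A set recursion with h is simulated by
--     a function recursion with h', which hands h the set range(x, f↾x) =
--     {f(z) : z ∈ x} instead of f↾x; `range` is again a PCSF⁻ function.
module Submission where

open import Defs
open import Data.Nat using (zero; suc)
open import Data.Fin using (Fin; zero; suc; inject₁; fromℕ; _↑ˡ_; _↑ʳ_)
open import Data.Vec using (Vec; []; _∷_; _∷ʳ_; _++_; head; init; last; lookup; tabulate)
open import Data.Vec.Properties using (lookup-++ˡ; lookup-++ʳ; tabulate-cong; tabulate∘lookup)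
open import Data.Vec.Relation.Unary.All using (All; []; _∷_)
open import Data.Vec.Relation.Unary.All.Properties using (lookup⁺)
open import Data.Product using (_×_; _,_; ∃; proj₁; proj₂)
open import Data.Sum using (_⊎_; inj₁; inj₂)
open import Data.Empty using (⊥-elim)
open import Relation.Nullary using (¬_; yes; no)
open import Relation.Binary.PropositionalEquality
  using (_≡_; refl; sym; trans; cong; cong₂; subst; module ≡-Reasoning)

snoc : ∀ {m} {B : Set} → (Fin m → B) → B → Fin (suc m) → B
snoc {zero}  f b _       = b
snoc {suc m} f b zero    = f zero
snoc {suc m} f b (suc i) = snoc (λ j → f (suc j)) b i

tabulate-snoc : ∀ {m} {B C : Set} (g : B → C) (f : Fin m → B) (b : B) →
  tabulate (λ i → g (snoc f b i)) ≡ tabulate (λ j → g (f j)) ∷ʳ g b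
tabulate-snoc {zero}  g f b = refl
tabulate-snoc {suc m} g f b = cong (g (f zero) ∷_) (tabulate-snoc g (λ j → f (suc j)) b)

snoc-all : ∀ {m} {B : Set} {P : B → Set} {f : Fin m → B} {b : B} →
  (∀ j → P (f j)) → P b → ∀ i → P (snoc f b i)
snoc-all {zero}  pf pb _       = pb
snoc-all {suc m} pf pb zero    = pf zero
snoc-all {suc m} {P = P} pf pb (suc i) = snoc-all {P = P} (λ j → pf (suc j)) pb i

lookup-∷ʳ-inject₁ : ∀ {m} {A : Set} (as : Vec A m) (y : A) (j : Fin m) →
  lookup (as ∷ʳ y) (inject₁ j) ≡ lookup as j
lookup-∷ʳ-inject₁ (a ∷ as) y zero    = refl
lookup-∷ʳ-inject₁ (a ∷ as) y (suc j) = lookup-∷ʳ-inject₁ as y j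

lookup-∷ʳ-fromℕ : ∀ {m} {A : Set} (as : Vec A m) (y : A) → lookup (as ∷ʳ y) (fromℕ m) ≡ y
lookup-∷ʳ-fromℕ []       y = refl
lookup-∷ʳ-fromℕ (a ∷ as) y = lookup-∷ʳ-fromℕ as y

module Construction (U : SetUniverse) where
  open SetUniverse U

  ⊆-antisym : ∀ {a b} → (∀ z → z ∈ a → z ∈ b) → (∀ z → z ∈ b → z ∈ a) → a ≡ b
  ⊆-antisym a⊆b b⊆a = extensionality _ _ (λ z → a⊆b z , b⊆a z)

  ≡∅ : ∀ {a} → (∀ z → ¬ z ∈ a) → a ≡ ∅
  ≡∅ empty = ⊆-antisym (λ z z∈a → ⊥-elim (empty z z∈a)) (λ z z∈∅ → ⊥-elim (∅-spec z z∈∅))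

  singleton : V → V
  singleton a = pair a a

  ∈-pairˡ : ∀ a b → a ∈ pair a b
  ∈-pairˡ a b = proj₂ (pair-spec a b a) (inj₁ refl)

  ∈-pairʳ : ∀ a b → b ∈ pair a b
  ∈-pairʳ a b = proj₂ (pair-spec a b b) (inj₂ refl)

  ∈-pair⁻ : ∀ {a b z} → z ∈ pair a b → z ≡ a ⊎ z ≡ b
  ∈-pair⁻ {a} {b} {z} = proj₁ (pair-spec a b z)

  ∈-singleton⁻ : ∀ {a z} → z ∈ singleton a → z ≡ a
  ∈-singleton⁻ z∈ with ∈-pair⁻ z∈
  ... | inj₁ z≡a = z≡a
  ... | inj₂ z≡a = z≡a

  ∈-⋃⁺ : ∀ {a w z} → w ∈ a → z ∈ w → z ∈ ⋃ a
  ∈-⋃⁺ {a} {w} {z} w∈a z∈w = proj₂ (⋃-spec a z) (w , w∈a , z∈w)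

  ∈-⋃⁻ : ∀ {a z} → z ∈ ⋃ a → ∃ λ w → w ∈ a × z ∈ w
  ∈-⋃⁻ {a} {z} = proj₁ (⋃-spec a z)

  ∈-sep⁺ : ∀ {P c z} → z ∈ c → P z → z ∈ sep P c
  ∈-sep⁺ {P} {c} {z} z∈c Pz = proj₂ (sep-spec P c z) (z∈c , Pz)

  ∈-sep⁻ : ∀ {P c z} → z ∈ sep P c → z ∈ c × P z
  ∈-sep⁻ {P} {c} {z} = proj₁ (sep-spec P c z)

  ∈-image⁺ : ∀ {F x w} → w ∈ x → F w ∈ image F x
  ∈-image⁺ {F} {x} {w} w∈x = proj₂ (image-spec F x (F w)) (w , w∈x , refl)

  ∈-image⁻ : ∀ {F x z} → z ∈ image F x → ∃ λ w → w ∈ x × z ≡ F w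
  ∈-image⁻ {F} {x} {z} = proj₁ (image-spec F x z)

  pair-≡ : ∀ {a b c d} → pair a b ≡ pair c d → (a ≡ c × b ≡ d) ⊎ (a ≡ d × b ≡ c)
  pair-≡ {a} {b} {c} {d} e
    with ∈-pair⁻ (subst (a ∈_) e (∈-pairˡ a b)) | ∈-pair⁻ (subst (b ∈_) e (∈-pairʳ a b))
  ... | inj₁ a≡c | inj₂ b≡d = inj₁ (a≡c , b≡d)
  ... | inj₂ a≡d | inj₁ b≡c = inj₂ (a≡d , b≡c)
  ... | inj₁ a≡c | inj₁ b≡c with ∈-pair⁻ (subst (d ∈_) (sym e) (∈-pairʳ c d))
  ...   | inj₁ d≡a = inj₁ (a≡c , trans b≡c (trans (sym a≡c) (sym d≡a)))
  ...   | inj₂ d≡b = inj₁ (a≡c , sym d≡b)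
  pair-≡ {a} {b} {c} {d} e | inj₂ a≡d | inj₂ b≡d with ∈-pair⁻ (subst (c ∈_) (sym e) (∈-pairˡ c d))
  ...   | inj₁ c≡a = inj₁ (sym c≡a , b≡d)
  ...   | inj₂ c≡b = inj₁ (trans a≡d (trans (sym b≡d) (sym c≡b)) , b≡d)

  kpair-member : ∀ {c d w} → w ∈ kpair U c d → c ∈ w
  kpair-member {c} {d} w∈ with ∈-pair⁻ w∈
  ... | inj₁ refl = ∈-pairˡ c c
  ... | inj₂ refl = ∈-pairˡ c d

  -- Kuratowski pairs are injective: first components agree since c lies in
  -- {a}; second components by comparing the remaining elements.
  kpair-injective : ∀ {a b c d} → kpair U a b ≡ kpair U c d → a ≡ c × b ≡ d
  kpair-injective {a} {b} {c} {d} e = a≡c , second-components (pair-≡ e)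
    where
    a≡c : a ≡ c
    a≡c = sym (∈-singleton⁻ (kpair-member (subst (singleton a ∈_) e (∈-pairˡ _ _))))
    second-components : (singleton a ≡ singleton c × pair a b ≡ pair c d)
                      ⊎ (singleton a ≡ pair c d × pair a b ≡ singleton c) → b ≡ d
    second-components (inj₁ (_ , e₂)) with pair-≡ e₂
    ... | inj₁ (_ , b≡d)     = b≡d
    ... | inj₂ (a≡d , b≡c)   = trans b≡c (trans (sym a≡c) a≡d)
    second-components (inj₂ (e₁ , e₂)) =
      trans (∈-singleton⁻ (subst (b ∈_) e₂ (∈-pairʳ a b)))
            (trans (sym a≡c) (sym (∈-singleton⁻ (subst (d ∈_) (sym e₁) (∈-pairʳ c d)))))

  -- The membership test Cond∈({∅}, ∅, c, d): nonempty exactly when c ∈ d.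
  -- It lets safe separation (which separates by nonemptiness) test membership.
  member : V → V → V
  member c d = condFn U (singleton ∅ ∷ ∅ ∷ c ∷ d ∷ [])

  member-≢∅ : ∀ c d → c ∈ d → ¬ member c d ≡ ∅
  member-≢∅ c d c∈d with c ∈? d
  ... | yes _   = λ e → ∅-spec ∅ (subst (∅ ∈_) e (∈-pairˡ ∅ ∅))
  ... | no c∉d  = ⊥-elim (c∉d c∈d)

  member-∈ : ∀ c d → ¬ member c d ≡ ∅ → c ∈ d
  member-∈ c d nonempty with c ∈? d
  ... | yes c∈d = c∈d
  ... | no _    = ⊥-elim (nonempty refl)

  sep-member : ∀ (s t : V → V) c →
    sep (λ b → ¬ member (s b) (t b) ≡ ∅) c ≡ sep (λ b → s b ∈ t b) c
  sep-member s t c = ⊆-antisym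
    (λ z z∈ → let z∈c , test = ∈-sep⁻ z∈ in ∈-sep⁺ z∈c (member-∈ _ _ test))
    (λ z z∈ → let z∈c , s∈t = ∈-sep⁻ z∈ in ∈-sep⁺ z∈c (member-≢∅ _ _ s∈t))

  compose⁻ : ∀ {k m} {h : Vec V k → V} {ts : Vec (Vec V m → V) k} →
    PCSF⁻ U h → All (PCSF⁻ U) ts → PCSF⁻ U (λ as → h (tabulate (λ i → lookup ts i as)))
  compose⁻ hp tps = comp⁻ hp (lookup⁺ tps)

  empty⁻ : ∀ {m} → PCSF⁻ U {m} (λ _ → ∅)
  empty⁻ = compose⁻ null⁻ []

  pairOf⁻ : ∀ {m} {s t : Vec V m → V} → PCSF⁻ U s → PCSF⁻ U t →
    PCSF⁻ U (λ as → pair (s as) (t as))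
  pairOf⁻ sp tp = compose⁻ pair⁻ (sp ∷ tp ∷ [])

  unionOf⁻ : ∀ {m} {t : Vec V m → V} → PCSF⁻ U t → PCSF⁻ U (λ as → ⋃ (t as))
  unionOf⁻ tp = compose⁻ union⁻ (tp ∷ [])

  kpairOf⁻ : ∀ {m} {s t : Vec V m → V} → PCSF⁻ U s → PCSF⁻ U t →
    PCSF⁻ U (λ as → kpair U (s as) (t as))
  kpairOf⁻ sp tp = pairOf⁻ (pairOf⁻ sp sp) (pairOf⁻ sp tp)

  memberOf⁻ : ∀ {m} {s t : Vec V m → V} → PCSF⁻ U s → PCSF⁻ U t →
    PCSF⁻ U (λ as → member (s as) (t as))
  memberOf⁻ sp tp = compose⁻ cond⁻ (pairOf⁻ empty⁻ empty⁻ ∷ empty⁻ ∷ sp ∷ tp ∷ [])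

  sepMember⁻ : ∀ {m} {s t : Vec V (suc m) → V} → PCSF⁻ U s → PCSF⁻ U t →
    PCSF⁻ U (λ as → sep (λ b → s (init as ∷ʳ b) ∈ t (init as ∷ʳ b)) (last as))
  sepMember⁻ {s = s} {t} sp tp = ext⁻ (sep⁻ (memberOf⁻ sp tp))
    (λ as → sym (sep-member (λ b → s (init as ∷ʳ b)) (λ b → t (init as ∷ʳ b)) (last as)))

  Binary⁻ : (V → V → V) → Set
  Binary⁻ F = PCSF⁻ U {2} (λ as → F (lookup as zero) (lookup as (suc zero)))

  second : V → V → V
  second x p = ⋃ (sep (λ y → p ∈ singleton (kpair U x y)) (⋃ p))

  second-kpair : ∀ x d → second x (kpair U x d) ≡ d
  second-kpair x d = ⊆-antisym extracted⊆d d⊆extracted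
    where
    extracted⊆d : ∀ z → z ∈ second x (kpair U x d) → z ∈ d
    extracted⊆d z z∈ with ∈-⋃⁻ z∈
    ... | y , y∈ , z∈y =
      subst (z ∈_) (sym (proj₂ (kpair-injective (∈-singleton⁻ (proj₂ (∈-sep⁻ y∈)))))) z∈y
    d⊆extracted : ∀ z → z ∈ d → z ∈ second x (kpair U x d)
    d⊆extracted z z∈d = ∈-⋃⁺ (∈-sep⁺ (∈-⋃⁺ (∈-pairʳ _ _) (∈-pairʳ x d)) (∈-pairˡ _ _)) z∈d

  second⁻ : Binary⁻ second
  second⁻ = unionOf⁻ (compose⁻
    (sepMember⁻ (proj⁻ (suc zero)) (pairOf⁻ x,y⁻ x,y⁻))
    (proj⁻ zero ∷ proj⁻ (suc zero) ∷ unionOf⁻ (proj⁻ (suc zero)) ∷ []))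
    where
    x,y⁻ : PCSF⁻ U (λ as → kpair U (lookup as zero) (lookup as (suc (suc zero))))
    x,y⁻ = kpairOf⁻ (proj⁻ zero) (proj⁻ (suc (suc zero)))

  range : V → V → V
  range x r = sep (λ y → ¬ sep (λ z → kpair U z y ∈ r) x ≡ ∅) (⋃ (⋃ r))

  -- The decidability of membership in {F z : z ∈ x} turns "the set of
  -- witnesses is nonempty" into actual membership.
  range-graph : ∀ x (F : V → V) → range x (image (λ z → kpair U z (F z)) x) ≡ image F x
  range-graph x F = ⊆-antisym range⊆image image⊆range
    where
    graph = image (λ z → kpair U z (F z)) x
    range⊆image : ∀ w → w ∈ range x graph → w ∈ image F x
    range⊆image w w∈ with w ∈? image F x
    ... | yes w∈image = w∈image
    ... | no w∉image = ⊥-elim (proj₂ (∈-sep⁻ w∈) (≡∅ no-witness))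
      where
      no-witness : ∀ z → ¬ z ∈ sep (λ z → kpair U z w ∈ graph) x
      no-witness z z∈ with ∈-image⁻ (proj₂ (∈-sep⁻ z∈))
      ... | z′ , z′∈x , e =
        w∉image (subst (_∈ image F x) (sym (proj₂ (kpair-injective e))) (∈-image⁺ z′∈x))
    image⊆range : ∀ w → w ∈ image F x → w ∈ range x graph
    image⊆range w w∈ with ∈-image⁻ w∈
    ... | z , z∈x , refl =
      ∈-sep⁺ (∈-⋃⁺ (∈-⋃⁺ (∈-image⁺ z∈x) (∈-pairʳ _ _)) (∈-pairʳ z (F z)))
             (λ e → ∅-spec z (subst (z ∈_) e (∈-sep⁺ z∈x (∈-image⁺ z∈x))))

  range⁻ : Binary⁻ range
  range⁻ = compose⁻ (sep⁻ witnesses⁻)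
    (proj⁻ zero ∷ proj⁻ (suc zero) ∷ unionOf⁻ (unionOf⁻ (proj⁻ (suc zero))) ∷ [])
    where
    -- (x, r, y) ↦ {z ∈ x : ⟨z,y⟩ ∈ r}: separation over x, moved to the last place
    witnesses⁻ : PCSF⁻ U (λ as → sep (λ z → kpair U z (lookup as (suc (suc zero))) ∈ lookup as (suc zero))
                                     (lookup as zero))
    witnesses⁻ = compose⁻ (sepMember⁻ (kpairOf⁻ (proj⁻ (suc (suc zero))) (proj⁻ (suc zero))) (proj⁻ zero))
      (proj⁻ (suc zero) ∷ proj⁻ (suc (suc zero)) ∷ proj⁻ zero ∷ [])

  applyBase : ∀ {n m k} {g : Vec V k → V} {ts : Vec (Fn U n m) k} →
    PCSF⁻ U g → All (PCSF U) ts → PCSF U (λ xs as → g (tabulate (λ j → lookup ts j xs as)))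
  applyBase gp tps = scomp {rs = λ ()} (base gp) (λ ()) (lookup⁺ tps)

  functionRecursion : ∀ {n m} (h : Fn U (suc n) (suc m)) (f : Fn U (suc n) m) → PCSF U h →
    (∀ x ys as → f (x ∷ ys) as ≡ h (x ∷ ys) (as ∷ʳ restrict U f ys as x)) → PCSF U f
  functionRecursion h f hp f-rec =
    ext (applyBase second⁻ (proj zero ∷ tagged-f ∷ []))
        (λ { (x ∷ ys) as → sym (second-kpair x (f (x ∷ ys) as)) })
    where
    -- x ↦ ⟨x, f(x)⟩ is given by set recursion, since {⟨z, f(z)⟩ : z ∈ x} = f↾x.
    tagged-f : PCSF U (λ xs as → kpair U (head xs) (f xs as))
    tagged-f = srec (applyBase (kpairOf⁻ (proj⁻ zero) (proj⁻ (suc zero))) (proj zero ∷ hp ∷ []))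
                    (λ x ys as → cong (kpair U x) (f-rec x ys as))

  -- replaceLast h g runs h with its last safe argument b replaced by
  -- g(x⃗/a⃗,b), expressed as a safe composition of h with projections and g.
  replaceLast : ∀ {n m} → Fn U n (suc m) → Fn U n (suc m) → Fn U n (suc m)
  replaceLast {n} h g xs bs =
    h (tabulate (λ i → lookup (xs ++ []) (i ↑ˡ 0)))
      (tabulate (λ i → snoc (λ j xs bs → lookup (xs ++ bs) (n ↑ʳ inject₁ j)) g i xs bs))

  replaceLast-PCSFfr : ∀ {n m} {h g : Fn U n (suc m)} → PCSFfr U h → PCSFfr U g →
    PCSFfr U (replaceLast h g)
  replaceLast-PCSFfr {n} hp gp =
    scomp hp (λ i → proj (i ↑ˡ 0)) (snoc-all {P = PCSFfr U} (λ j → proj (n ↑ʳ inject₁ j)) gp)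

  replaceLast-∷ʳ : ∀ {n m} (h g : Fn U n (suc m)) xs as b →
    replaceLast h g xs (as ∷ʳ b) ≡ h xs (as ∷ʳ g xs (as ∷ʳ b))
  replaceLast-∷ʳ {n} h g xs as b = cong₂ h normal-args safe-args
    where
    normal-args : tabulate (λ i → lookup (xs ++ []) (i ↑ˡ 0)) ≡ xs
    normal-args = trans (tabulate-cong (lookup-++ˡ xs [])) (tabulate∘lookup xs)
    earlier-args : tabulate (λ j → lookup (xs ++ (as ∷ʳ b)) (n ↑ʳ inject₁ j)) ≡ as
    earlier-args = trans
      (tabulate-cong (λ j → trans (lookup-++ʳ xs (as ∷ʳ b) (inject₁ j)) (lookup-∷ʳ-inject₁ as b j)))
      (tabulate∘lookup as)
    safe-args : _ ≡ as ∷ʳ g xs (as ∷ʳ b)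
    safe-args = trans (tabulate-snoc (λ G → G xs (as ∷ʳ b)) _ g) (cong (_∷ʳ _) earlier-args)

  rangeLast : ∀ {n m} → Fn U (suc n) (suc m)
  rangeLast {n} {m} xs bs = range (lookup (xs ++ bs) zero) (lookup (xs ++ bs) (suc n ↑ʳ fromℕ m))

  rangeLast-PCSFfr : ∀ {n m} → PCSFfr U (rangeLast {n} {m})
  rangeLast-PCSFfr {n} {m} =
    scomp {rs = λ ()} (base range⁻) (λ ())
          (lookup⁺ {P = PCSFfr U} (proj zero ∷ proj (suc n ↑ʳ fromℕ m) ∷ []))

  rangeLast-∷ʳ : ∀ {n m} x ys (as : Vec V m) r → rangeLast {n} (x ∷ ys) (as ∷ʳ r) ≡ range x r
  rangeLast-∷ʳ {m = m} x ys as r =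
    cong (range x) (trans (lookup-++ʳ (x ∷ ys) (as ∷ʳ r) (fromℕ m)) (lookup-∷ʳ-fromℕ as r))

  setToFunctionRecursion : ∀ {n m} {f : Fn U n m} → PCSF U f → PCSFfr U f
  setToFunctionRecursion (base gp)          = base gp
  setToFunctionRecursion (proj j)           = proj j
  setToFunctionRecursion (scomp hp rps tps) =
    scomp (setToFunctionRecursion hp) (λ i → setToFunctionRecursion (rps i))
          (λ j → setToFunctionRecursion (tps j))
  setToFunctionRecursion (ext p e)          = ext (setToFunctionRecursion p) e
  setToFunctionRecursion (srec {h = h} {f} hp f-rec) =
    frec (replaceLast-PCSFfr (setToFunctionRecursion hp) rangeLast-PCSFfr) step
    where
    open ≡-Reasoning
    step : ∀ x ys as → f (x ∷ ys) as ≡ replaceLast h rangeLast (x ∷ ys) (as ∷ʳ restrict U f ys as x)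
    step x ys as = begin
      f (x ∷ ys) as
        ≡⟨ f-rec x ys as ⟩
      h (x ∷ ys) (as ∷ʳ image (λ z → f (z ∷ ys) as) x)
        ≡⟨ cong (λ c → h (x ∷ ys) (as ∷ʳ c)) (sym (range-graph x _)) ⟩
      h (x ∷ ys) (as ∷ʳ range x graph)
        ≡⟨ cong (λ c → h (x ∷ ys) (as ∷ʳ c)) (sym (rangeLast-∷ʳ x ys as graph)) ⟩
      h (x ∷ ys) (as ∷ʳ rangeLast (x ∷ ys) (as ∷ʳ graph))
        ≡⟨ sym (replaceLast-∷ʳ h rangeLast (x ∷ ys) as graph) ⟩
      replaceLast h rangeLast (x ∷ ys) (as ∷ʳ graph) ∎
      where
      graph = restrict U f ys as x

proposition3p2p12 : (U : SetUniverse) →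
    ((∀ {n m} (h : Fn U (suc n) (suc m)) (f : Fn U (suc n) m) → PCSF U h →
        (∀ x ys as → f (x ∷ ys) as ≡ h (x ∷ ys) (as ∷ʳ restrict U f ys as x)) →
        PCSF U f)
    × (∀ {n m} (f : Fn U n m) → PCSF U f → PCSFfr U f))
proposition3p2p12 U = functionRecursion , λ _ → setToFunctionRecursion
  where open Construction U
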